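{- If a first-order formula $\alpha(x)\in\mathcal{FOL}$ with one free variable $x$ is preserved by meet-simulations, then it is also preserved by L$_1$-simulations.
   Context: A meet-semilattice $(W,1,\curlywedge)$ is a poset in which every finite subset has a meet; $\curlywedge$ binary meet, $1$ top, $w\preccurlyeq v$ iff $w\curlywedge v=w$. A filter is a $\preccurlyeq$-upward closed subset closed under finite meets. An L$_1$-model $(W,1,\curlywedge,V)$ is a meet-semilattice with a filter $V(p)$ for each $p$ in a fixed set $\mathrm{Prop}$. $\mathcal{FOL}$ is the first-order language with a binary predicate $R$ and unary predicates $P_p$ ($p\in\mathrm{Prop}$); $\mathfrak{M}^{\circ}$ is the $\mathcal{FOL}$-structure with domain $W$, $R$ as $\preccurlyeq$, $P_p$ as $V(p)$. An L$_1$-simulation from $\mathfrak{M}$ to $\mathfrak{M}'=(W',1',\curlywedge',V')$ is $S\subseteq W\times W'$ such that for all $(w,w')\in S$: (S1) $w\in V(p)$ implies $w'\in V'(p)$; (S2) $w=1$ implies $w'=1'$; (S3) if $v\curlywedge u\preccurlyeq w$ then there exist $v',u'$ with $(v,v'),(u,u')\in S$ and $v'\curlywedge'u'\preccurlyeq'w'$. A meet-simulation from $\mathfrak{M}$ to $\mathfrak{M}'$ is $T\subseteq W\times W\times W'$ such that for all $(w_1,w_2,w')\in T$: (M1) if $w_1,w_2\in V(p)$ then $w'\in V'(p)$; (M2) if $w_1=w_2=1$ then $w'=1'$; (M3) if $u_1\curlywedge v_1\preccurlyeq w_1$ and $u_2\curlywedge v_2\preccurlyeq w_2$, then there exist $v',u'\in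 W'$ with $(u_1,u_2,u'),(v_1,v_2,v')\in T$ and $v'\curlywedge'u'\preccurlyeq'w'$. $\alpha(x)$ is preserved by L$_1$-simulations if whenever $S$ is an L$_1$-simulation from $\mathfrak{M}$ to $\mathfrak{M}'$ with $(w,w')\in S$ and $\mathfrak{M}^{\circ}\models\alpha(x)[w]$, then $\mathfrak{M}'^{\circ}\models\alpha(x)[w']$. $\alpha(x)$ is preserved by meet-simulations if whenever $T$ is a meet-simulation from $\mathfrak{M}$ to $\mathfrak{M}'$ with $(w_1,w_2,w')\in T$, $\mathfrak{M}^{\circ}\models\alpha(x)[w_1]$ and $\mathfrak{M}^{\circ}\models\alpha(x)[w_2]$, then $\mathfrak{M}'^{\circ}\models\alpha(x)[w']$. -}

module Defs where

open import Level using (0ℓ)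
open import Data.Nat using (ℕ; suc)
open import Data.Fin using (Fin; zero; suc)
open import Data.Empty using (⊥)
open import Data.Unit using (⊤)
open import Data.Product using (Σ; _×_; ∃-syntax)
open import Data.Sum using (_⊎_)
open import Relation.Nullary using (¬_)
open import Relation.Binary.PropositionalEquality using (_≡_)
open import Relation.Binary.Lattice.Structures using (IsBoundedMeetSemilattice)

record L1Model (Prop : Set) : Set₁ where
  field
    W     : Set
    _≼_   : W → W → Set
    _⋏_   : W → W → W
    one   : W
    isBMS : IsBoundedMeetSemilattice {A = W} _≡_ _≼_ _⋏_ one
    V     : Prop → W → Set
    V-up  : ∀ p {w v} → V p w → w ≼ v → V p v
    V-one : ∀ p → V p one
    V-⋏   : ∀ p {w v} → V p w → V p v → V p (w ⋏ v)

open L1Model public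

-- The first-order language FOL: binary R, unary P_p, equality,
-- variables only as terms (de Bruijn indices; Formula n has n free vars).

data Formula (Prop : Set) : ℕ → Set where
  Rel  : ∀ {n} → Fin n → Fin n → Formula Prop n
  Pred : ∀ {n} → Prop → Fin n → Formula Prop n
  Eq   : ∀ {n} → Fin n → Fin n → Formula Prop n
  fls  : ∀ {n} → Formula Prop n
  tru  : ∀ {n} → Formula Prop n
  neg  : ∀ {n} → Formula Prop n → Formula Prop n
  and  : ∀ {n} → Formula Prop n → Formula Prop n → Formula Prop n
  or   : ∀ {n} → Formula Prop n → Formula Prop n → Formula Prop n
  imp  : ∀ {n} → Formula Prop n → Formula Prop n → Formula Prop n
  all  : ∀ {n} → Formula Prop (suc n) → Formula Prop n
  ex   : ∀ {n} → Formula Prop (suc n) → Formula Prop n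

extend : ∀ {A : Set} {n} → A → (Fin n → A) → Fin (suc n) → A
extend a ρ zero    = a
extend a ρ (suc i) = ρ i

Sat : ∀ {Prop} (M : L1Model Prop) {n} → Formula Prop n → (Fin n → W M) → Set
Sat M (Rel i j)  ρ = _≼_ M (ρ i) (ρ j)
Sat M (Pred p i) ρ = V M p (ρ i)
Sat M (Eq i j)   ρ = ρ i ≡ ρ j
Sat M fls        ρ = ⊥
Sat M tru        ρ = ⊤
Sat M (neg φ)    ρ = ¬ Sat M φ ρ
Sat M (and φ ψ)  ρ = Sat M φ ρ × Sat M ψ ρ
Sat M (or φ ψ)   ρ = Sat M φ ρ ⊎ Sat M ψ ρ
Sat M (imp φ ψ)  ρ = Sat M φ ρ → Sat M ψ ρ
Sat M (all φ)    ρ = ∀ a → Sat M φ (extend a ρ)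
Sat M (ex φ)     ρ = Σ (W M) λ a → Sat M φ (extend a ρ)

_⊨_[_] : ∀ {Prop} (M : L1Model Prop) → Formula Prop 1 → W M → Set
M ⊨ α [ w ] = Sat M α (λ _ → w)

record IsL1Simulation {Prop} (M M' : L1Model Prop) (S : W M → W M' → Set) : Set where
  field
    S1 : ∀ {w w'} → S w w' → ∀ p → V M p w → V M' p w'
    S2 : ∀ {w w'} → S w w' → w ≡ one M → w' ≡ one M'
    S3 : ∀ {w w'} → S w w' → ∀ v u → _≼_ M (_⋏_ M v u) w →
         ∃[ v' ] ∃[ u' ] (S v v' × S u u' × _≼_ M' (_⋏_ M' v' u') w')

record IsMeetSimulation {Prop} (M M' : L1Model Prop) (T : W M → W M → W M' → Set) : Set where
  field
    M1 : ∀ {w₁ w₂ w'} → T w₁ w₂ w' → ∀ p → V M p w₁ → V M p w₂ → V M' p w'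
    M2 : ∀ {w₁ w₂ w'} → T w₁ w₂ w' → w₁ ≡ one M → w₂ ≡ one M → w' ≡ one M'
    M3 : ∀ {w₁ w₂ w'} → T w₁ w₂ w' → ∀ u₁ v₁ u₂ v₂ →
         _≼_ M (_⋏_ M u₁ v₁) w₁ → _≼_ M (_⋏_ M u₂ v₂) w₂ →
         ∃[ v' ] ∃[ u' ] (T u₁ u₂ u' × T v₁ v₂ v' × _≼_ M' (_⋏_ M' v' u') w')

PreservedByL1Sim : ∀ {Prop} → Formula Prop 1 → Set₁
PreservedByL1Sim {Prop} α =
  (M M' : L1Model Prop) (S : W M → W M' → Set) → IsL1Simulation M M' S →
  ∀ w w' → S w w' → M ⊨ α [ w ] → M' ⊨ α [ w' ]

PreservedByMeetSim : ∀ {Prop} → Formula Prop 1 → Set₁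
PreservedByMeetSim {Prop} α =
  (M M' : L1Model Prop) (T : W M → W M → W M' → Set) → IsMeetSimulation M M' T →
  ∀ w₁ w₂ w' → T w₁ w₂ w' → M ⊨ α [ w₁ ] → M ⊨ α [ w₂ ] → M' ⊨ α [ w' ]

-- An L1-simulation S becomes a meet-simulation by ignoring the second
-- source point: T (w₁ , w₂ , w') := S w₁ w'.  Each meet-simulation clause
-- then reduces to the corresponding L1-simulation clause for w₁, up to the
-- commutativity of ⋏ in M' (M3 lists the witnesses in the other order).
-- Applying preservation by T to the triple (w , w , w') gives the claim.
module Submission where

open import Level using (0ℓ)
open import Data.Product using (_,_)
open import Relation.Binary.PropositionalEquality using (subst)
open import Relation.Binary.Lattice.Bundles using (MeetSemilattice)
import Relation.Binary.Lattice.Properties.MeetSemilattice as MeetSemilatticeProperties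
open import Relation.Binary.Lattice.Structures using (IsBoundedMeetSemilattice)

open import Defs

meetSemilattice : ∀ {Prop} → L1Model Prop → MeetSemilattice 0ℓ 0ℓ 0ℓ
meetSemilattice M = record
  { isMeetSemilattice = IsBoundedMeetSemilattice.isMeetSemilattice (isBMS M) }

⋏-comm-≼ : ∀ {Prop} (M : L1Model Prop) {x y w} →
           _≼_ M (_⋏_ M x y) w → _≼_ M (_⋏_ M y x) w
⋏-comm-≼ M {x} {y} = subst (λ z → _≼_ M z _) (∧-comm x y)
  where open MeetSemilatticeProperties (meetSemilattice M)

forgetSecond : {A B : Set} → (A → B → Set) → A → A → B → Set
forgetSecond S w₁ _ w' = S w₁ w'

isMeetSimulation-forgetSecond : ∀ {Prop} {M M' : L1Model Prop} {S} →
  IsL1Simulation M M' S → IsMeetSimulation M M' (forgetSecond S)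
isMeetSimulation-forgetSecond {M' = M'} isS = record
  { M1 = λ s p w₁∈V _ → S1 s p w₁∈V
  ; M2 = λ s w₁≡one _ → S2 s w₁≡one
  ; M3 = λ s u₁ v₁ _ _ u₁⋏v₁≼w₁ _ →
      let (u' , v' , su , sv , u'⋏v'≼w') = S3 s u₁ v₁ u₁⋏v₁≼w₁
      in v' , u' , su , sv , ⋏-comm-≼ M' u'⋏v'≼w'
  }
  where open IsL1Simulation isS

corollary7p9 : (Prop : Set) (α : Formula Prop 1) →
    PreservedByMeetSim α → PreservedByL1Sim α
corollary7p9 Prop α preserved M M' S isS w w' s w⊨α =
  preserved M M' (forgetSecond S) (isMeetSimulation-forgetSecond isS)
            w w w' s w⊨α w⊨α
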